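{- For $\pi\in S_n(132)$ we have $(12])\,\pi=(21])\,\phi(\pi)$ and $(21])\,\pi=(12])\,\phi(\pi)$, where $(12])$ denotes the number of occurrences of the pattern $12$ whose last letter is the last letter of the permutation, and $(21])$ the number of occurrences of the pattern $21$ whose last letter is the last letter of the permutation. Equivalently, $\pi_n-1=n-\phi(\pi)_n$ and $n-\pi_n=\phi(\pi)_n-1$.
   Context: Permutations are written in one-line notation; $S_n(132)$ is the set of permutations of length $n$ avoiding the classical pattern $132$. For permutations $\alpha,\beta$, the skew sum $\alpha\ominus\beta$ is the permutation of length $|\alpha|+|\beta|$ whose first $|\alpha|$ entries are $\alpha_i+|\beta|$ and whose last $|\beta|$ entries are $\beta_j$; the direct sum $\alpha\oplus\beta$ has first $|\alpha|$ entries $\alpha_i$ and last $|\beta|$ entries $\beta_j+|\alpha|$. Every nonempty $\pi\in S_n(132)$ can be uniquely written as $\pi=\alpha\ominus(\beta\oplus 1)$ with $\alpha,\beta$ (possibly empty) $132$-avoiding permutations. The map $\phi$ on $S_n(132)$ is defined recursively: $\phi$ of the empty permutation is the empty permutation, and if $\pi=\alpha\ominus(\beta\oplus 1)$ then $\phi(\pi)=\phi(\beta)\ominus(\phi(\alpha)\oplus 1)$; $\phi$ is an involution on $S_n(132)$ preserving length. For a pattern ending with a hook, an occurrence must end with the rightmost letter of the permutation; thus $(12])\,\pi=\pi_n-1$ and $(21])\,\pi=n-\pi_n$. -}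

module Defs where

open import Data.Nat using (ℕ; zero; suc; _+_; _∸_; _<_; _<?_)
open import Data.Nat.Properties using ()
open import Data.List using (List; []; _∷_; _++_; [_]; map; filter; length; reverse; upTo; last; lookup)
open import Data.List.Relation.Binary.Permutation.Propositional using (_↭_)
open import Data.Maybe using (Maybe; just; nothing)
open import Data.Fin using (Fin; toℕ)
open import Data.Product using (_×_)
open import Relation.Nullary using (¬_)
import Data.Fin as F

range : ℕ → List ℕ
range n = map suc (upTo n)

IsPerm : ℕ → List ℕ → Set
IsPerm n π = π ↭ range n

Avoids132 : List ℕ → Set
Avoids132 π = (i j k : Fin (length π)) → i F.< j → j F.< k →
  ¬ ((lookup π i < lookup π k) × (lookup π k < lookup π j))

InS132 : ℕ → List ℕ → Set
InS132 n π = IsPerm n π × Avoids132 π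

_⊖_ : List ℕ → List ℕ → List ℕ
α ⊖ β = map (_+ length β) α ++ β

_⊕_ : List ℕ → List ℕ → List ℕ
α ⊕ β = α ++ map (_+ length α) β

-- the last letter (0 for the empty permutation; never used there)
lastLetter : List ℕ → ℕ
lastLetter π with last π
... | just x = x
... | nothing = 0

-- decomposition π = α ⊖ (β ⊕ 1): the last letter k equals |β|+1,
-- β consists of the letters < k (in order), α of the letters > k, shifted down by k
decβ : List ℕ → List ℕ
decβ π = filter (_<? lastLetter π) π

decα : List ℕ → List ℕ
decα π = map (_∸ lastLetter π) (filter (lastLetter π <?_) π)

-- φ, computed with fuel (fuel = length suffices since |α|,|β| < |π|)
φ-fuel : ℕ → List ℕ → List ℕ
φ-fuel zero π = []
φ-fuel (suc f) [] = []
φ-fuel (suc f) (x ∷ xs) =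
  φ-fuel f (decβ (x ∷ xs)) ⊖ (φ-fuel f (decα (x ∷ xs)) ⊕ [ 1 ])

φ : List ℕ → List ℕ
φ π = φ-fuel (length π) π

hook12 : List ℕ → ℕ
hook12 π with reverse π
... | [] = 0
... | x ∷ xs = length (filter (_<? x) xs)

hook21 : List ℕ → ℕ
hook21 π with reverse π
... | [] = 0
... | x ∷ xs = length (filter (x <?_) xs)

module Submission where

-- Both hook statistics of a permutation σ of [1..m] are determined by its
-- last letter b: the letters smaller than b are exactly 1..b-1 and the
-- larger ones exactly b+1..m, so (12]) σ = b - 1 and (21]) σ = m - b.
-- Hence it suffices to show that φ(π) is again a permutation of [1..n] and
-- to locate its last letter.  Write π = α ⊖ (β ⊕ 1) with last letter a;
-- then α is a permutation of [1..n-a], and φ(π) = φ(β) ⊖ (φ(α) ⊕ 1) ends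
-- with |φ(α)| + 1 = n - a + 1.  Substituting b = n - a + 1 in the hook
-- formulas gives the theorem.

open import Defs
open import Data.Nat
open import Data.Nat.Properties
open import Data.List using (List; []; _∷_; _++_; [_]; map; filter; length; reverse; upTo; last)
open import Data.List.Properties
open import Data.List.Membership.Propositional using (_∈_)
open import Data.List.Membership.Propositional.Properties using (∈-map⁻; ∈-upTo⁻; ∈-++⁺ʳ)
open import Data.List.Relation.Unary.Any using (here)
import Data.List.Relation.Unary.All as All
open import Data.List.Relation.Binary.Permutation.Propositional using (_↭_; ↭-refl; ↭-trans; ↭-reflexive)
open import Data.List.Relation.Binary.Permutation.Propositional.Properties
  using (↭-length; filter-↭; map⁺; ++⁺; ++⁺ʳ; ++-comm; ∈-resp-↭; ↭-reverse)
open import Data.Maybe using (just)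
open import Data.Product using (_×_; _,_; proj₁; proj₂; ∃-syntax)
open import Function using (_∘_)
open import Relation.Unary using (Decidable)
open import Relation.Nullary using (¬_)
open import Relation.Binary.PropositionalEquality hiding ([_])
open ≡-Reasoning

range-∷ʳ : ∀ n → range (suc n) ≡ range n ++ [ suc n ]
range-∷ʳ n = trans (cong (map suc) (sym (upTo-∷ʳ n))) (map-++ suc (upTo n) [ n ])

length-range : ∀ n → length (range n) ≡ n
length-range n = trans (length-map suc (upTo n)) (length-upTo n)

length-perm : ∀ {π n} → π ↭ range n → length π ≡ n
length-perm {n = n} π↭ = trans (↭-length π↭) (length-range n)

∈-range : ∀ {x n} → x ∈ range n → 1 ≤ x × x ≤ n
∈-range x∈ with ∈-map⁻ suc x∈
... | y , y∈ , refl = s≤s z≤n , ∈-upTo⁻ y∈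

∈-shifted-range : ∀ {x s p} → x ∈ map (_+ s) (range p) → s < x
∈-shifted-range {s = s} x∈ with ∈-map⁻ (_+ s) x∈
... | y , y∈ , refl = +-monoˡ-≤ s (proj₁ (∈-range y∈))

range-shift : ∀ p s → range s ++ map (_+ s) (range p) ≡ range (p + s)
range-shift zero s = ++-identityʳ (range s)
range-shift (suc p) s = begin
  range s ++ map (_+ s) (range (suc p))              ≡⟨ cong (λ l → range s ++ map (_+ s) l) (range-∷ʳ p) ⟩
  range s ++ map (_+ s) (range p ++ [ suc p ])        ≡⟨ cong (range s ++_) (map-++ (_+ s) (range p) [ suc p ]) ⟩
  range s ++ map (_+ s) (range p) ++ [ suc p + s ]    ≡⟨ sym (++-assoc (range s) _ _) ⟩
  (range s ++ map (_+ s) (range p)) ++ [ suc p + s ]  ≡⟨ cong (_++ [ suc p + s ]) (range-shift p s) ⟩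
  range (p + s) ++ [ suc (p + s) ]                    ≡⟨ sym (range-∷ʳ (p + s)) ⟩
  range (suc p + s)                                   ∎

range-split : ∀ {k n} → k ≤ n → range n ≡ range k ++ map (_+ k) (range (n ∸ k))
range-split {k} {n} k≤n = sym (trans (range-shift (n ∸ k) k) (cong range (m∸n+n≡m k≤n)))

filter-below-range : ∀ {k n} → 1 ≤ k → k ≤ n → filter (_<? k) (range n) ≡ range (k ∸ 1)
filter-below-range {suc j} {n} _ k≤n = begin
  filter (_<? suc j) (range n)
    ≡⟨ cong (filter (_<? suc j)) (range-split j≤n) ⟩
  filter (_<? suc j) (range j ++ map (_+ j) (range (n ∸ j)))
    ≡⟨ filter-++ (_<? suc j) (range j) _ ⟩
  filter (_<? suc j) (range j) ++ filter (_<? suc j) (map (_+ j) (range (n ∸ j)))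
    ≡⟨ cong₂ _++_ (filter-all (_<? suc j) (All.tabulate lower))
                  (filter-none (_<? suc j) (All.tabulate upper)) ⟩
  range j ++ []
    ≡⟨ ++-identityʳ (range j) ⟩
  range j ∎
  where
    j≤n : j ≤ n
    j≤n = ≤-trans (n≤1+n j) k≤n
    lower : ∀ {x} → x ∈ range j → x < suc j
    lower = s≤s ∘ proj₂ ∘ ∈-range
    upper : ∀ {x} → x ∈ map (_+ j) (range (n ∸ j)) → ¬ x < suc j
    upper x∈ = <⇒≱ (∈-shifted-range x∈) ∘ s≤s⁻¹

filter-above-range : ∀ {k n} → k ≤ n → map (_∸ k) (filter (k <?_) (range n)) ≡ range (n ∸ k)
filter-above-range {k} {n} k≤n = begin
  map (_∸ k) (filter (k <?_) (range n))
    ≡⟨ cong (map (_∸ k) ∘ filter (k <?_)) (range-split k≤n) ⟩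
  map (_∸ k) (filter (k <?_) (range k ++ shifted))
    ≡⟨ cong (map (_∸ k)) (filter-++ (k <?_) (range k) shifted) ⟩
  map (_∸ k) (filter (k <?_) (range k) ++ filter (k <?_) shifted)
    ≡⟨ cong₂ (λ l r → map (_∸ k) (l ++ r))
             (filter-none (k <?_) (All.tabulate lower))
             (filter-all (k <?_) (All.tabulate ∈-shifted-range)) ⟩
  map (_∸ k) (map (_+ k) (range (n ∸ k)))
    ≡⟨ sym (map-∘ (range (n ∸ k))) ⟩
  map ((_∸ k) ∘ (_+ k)) (range (n ∸ k))
    ≡⟨ map-cong (λ y → m+n∸n≡m y k) (range (n ∸ k)) ⟩
  map (λ y → y) (range (n ∸ k))
    ≡⟨ map-id (range (n ∸ k)) ⟩
  range (n ∸ k) ∎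
  where
    shifted = map (_+ k) (range (n ∸ k))
    lower : ∀ {x} → x ∈ range k → ¬ k < x
    lower x∈ = ≤⇒≯ (proj₂ (∈-range x∈))

last-∷ʳ : ∀ (ys : List ℕ) b → last (ys ++ [ b ]) ≡ just b
last-∷ʳ [] b = refl
last-∷ʳ (y ∷ []) b = refl
last-∷ʳ (y ∷ z ∷ ys) b = last-∷ʳ (z ∷ ys) b

last-∷ʳ⁻ : ∀ (σ : List ℕ) {b} → last σ ≡ just b → ∃[ ys ] σ ≡ ys ++ [ b ]
last-∷ʳ⁻ (x ∷ []) refl = [] , refl
last-∷ʳ⁻ (x ∷ y ∷ σ) eq with last-∷ʳ⁻ (y ∷ σ) eq
... | ys , σ≡ = x ∷ ys , cong (x ∷_) σ≡

last-∷ : ∀ x (xs : List ℕ) → ∃[ b ] last (x ∷ xs) ≡ just b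
last-∷ x [] = x , refl
last-∷ x (y ∷ xs) = last-∷ y xs

lastLetter-last : ∀ (π : List ℕ) {b} → last π ≡ just b → lastLetter π ≡ b
lastLetter-last π eq with last π | eq
... | _ | refl = refl

last-range : ∀ {σ m b} → σ ↭ range m → last σ ≡ just b → 1 ≤ b × b ≤ m
last-range {σ} σ↭ eq with last-∷ʳ⁻ σ eq
... | ys , refl = ∈-range (∈-resp-↭ σ↭ (∈-++⁺ʳ ys (here refl)))

hook12-∷ʳ : ∀ ys b → hook12 (ys ++ [ b ]) ≡ length (filter (_<? b) (reverse ys))
hook12-∷ʳ ys b rewrite reverse-++ ys [ b ] = refl

hook21-∷ʳ : ∀ ys b → hook21 (ys ++ [ b ]) ≡ length (filter (b <?_) (reverse ys))
hook21-∷ʳ ys b rewrite reverse-++ ys [ b ] = refl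

count-reverse : ∀ {P : ℕ → Set} (P? : Decidable P) ys {b} → ¬ P b →
  length (filter P? (reverse ys)) ≡ length (filter P? (ys ++ [ b ]))
count-reverse P? ys {b} ¬Pb = begin
  length (filter P? (reverse ys))           ≡⟨ ↭-length (filter-↭ P? (↭-reverse ys)) ⟩
  length (filter P? ys)                     ≡⟨ cong length (sym (++-identityʳ (filter P? ys))) ⟩
  length (filter P? ys ++ [])               ≡⟨ cong (λ l → length (filter P? ys ++ l)) (sym (filter-reject P? ¬Pb)) ⟩
  length (filter P? ys ++ filter P? [ b ])  ≡⟨ cong length (sym (filter-++ P? ys [ b ])) ⟩
  length (filter P? (ys ++ [ b ]))          ∎

hooks-of-perm : ∀ {σ m b} → σ ↭ range m → last σ ≡ just b →
  hook12 σ ≡ b ∸ 1 × hook21 σ ≡ m ∸ b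
hooks-of-perm {σ} {m} {b} σ↭ eq with last-∷ʳ⁻ σ eq | last-range σ↭ eq
... | ys , refl | 1≤b , b≤m = hook12≡ , hook21≡
  where
    hook12≡ : hook12 (ys ++ [ b ]) ≡ b ∸ 1
    hook12≡ = begin
      hook12 (ys ++ [ b ])                   ≡⟨ hook12-∷ʳ ys b ⟩
      length (filter (_<? b) (reverse ys))   ≡⟨ count-reverse (_<? b) ys (<-irrefl refl) ⟩
      length (filter (_<? b) (ys ++ [ b ]))  ≡⟨ ↭-length (filter-↭ (_<? b) σ↭) ⟩
      length (filter (_<? b) (range m))      ≡⟨ cong length (filter-below-range 1≤b b≤m) ⟩
      length (range (b ∸ 1))                 ≡⟨ length-range (b ∸ 1) ⟩
      b ∸ 1                                  ∎
    hook21≡ : hook21 (ys ++ [ b ]) ≡ m ∸ b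
    hook21≡ = begin
      hook21 (ys ++ [ b ])                               ≡⟨ hook21-∷ʳ ys b ⟩
      length (filter (b <?_) (reverse ys))               ≡⟨ count-reverse (b <?_) ys (<-irrefl refl) ⟩
      length (filter (b <?_) (ys ++ [ b ]))              ≡⟨ ↭-length (filter-↭ (b <?_) σ↭) ⟩
      length (filter (b <?_) (range m))                  ≡⟨ sym (length-map (_∸ b) (filter (b <?_) (range m))) ⟩
      length (map (_∸ b) (filter (b <?_) (range m)))     ≡⟨ cong length (filter-above-range b≤m) ⟩
      length (range (m ∸ b))                             ≡⟨ length-range (m ∸ b) ⟩
      m ∸ b                                              ∎

decomposition-perm : ∀ {π n k} → π ↭ range n → last π ≡ just k →
  decβ π ↭ range (k ∸ 1) × decα π ↭ range (n ∸ k)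
decomposition-perm {π} {k = k} π↭ eq rewrite lastLetter-last π eq =
  ↭-trans (filter-↭ (_<? k) π↭) (↭-reflexive (filter-below-range 1≤k k≤n)) ,
  ↭-trans (map⁺ (_∸ k) (filter-↭ (k <?_) π↭)) (↭-reflexive (filter-above-range k≤n))
  where
    1≤k = proj₁ (last-range π↭ eq)
    k≤n = proj₂ (last-range π↭ eq)

direct-one-perm : ∀ {Y q} → Y ↭ range q → Y ⊕ [ 1 ] ↭ range (suc q)
direct-one-perm {q = q} Y↭ rewrite length-perm Y↭ | range-∷ʳ q =
  ++⁺ʳ [ suc q ] Y↭

skew-perm : ∀ {X Z p r} → X ↭ range p → Z ↭ range r → X ⊖ Z ↭ range (p + r)
skew-perm {p = p} {r} X↭ Z↭ rewrite length-perm Z↭ =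
  ↭-trans (++⁺ (map⁺ (_+ r) X↭) Z↭)
    (↭-trans (++-comm (map (_+ r) (range p)) (range r)) (↭-reflexive (range-shift p r)))

-- With fuel f + 1 ≥ n, the pieces β and α of π ∈ S_n (sizes k-1 and n-k)
-- fit into the remaining fuel f.
pieces-fit : ∀ {k n f} → 1 ≤ k → k ≤ n → n ≤ suc f → k ∸ 1 ≤ f × n ∸ k ≤ f
pieces-fit {n = n} 1≤k k≤n n≤f+1 =
  ∸-monoˡ-≤ 1 (≤-trans k≤n n≤f+1) , ≤-trans (∸-monoʳ-≤ n 1≤k) (∸-monoˡ-≤ 1 n≤f+1)

split-at-letter : ∀ {k n} → 1 ≤ k → k ≤ n → k ∸ 1 + suc (n ∸ k) ≡ n
split-at-letter {suc j} {n} _ k≤n = trans (+-suc j (n ∸ suc j)) (m+[n∸m]≡n k≤n)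

φ-fuel-perm : ∀ f {n} π → n ≤ f → π ↭ range n → φ-fuel f π ↭ range n
φ-fuel-perm zero π z≤n π↭ = ↭-refl
φ-fuel-perm (suc f) [] _ π↭ = π↭
φ-fuel-perm (suc f) {n} (x ∷ xs) n≤f+1 π↭ with last-∷ x xs
... | k , eq = subst (λ m → φ-fuel (suc f) π ↭ range m) (split-at-letter 1≤k k≤n)
  (skew-perm (φ-fuel-perm f (decβ π) (proj₁ fits) (proj₁ pieces))
             (direct-one-perm (φ-fuel-perm f (decα π) (proj₂ fits) (proj₂ pieces))))
  where
    π = x ∷ xs
    pieces = decomposition-perm π↭ eq
    1≤k = proj₁ (last-range π↭ eq)
    k≤n = proj₂ (last-range π↭ eq)
    fits = pieces-fit 1≤k k≤n n≤f+1

φ-perm : ∀ {π n} → π ↭ range n → φ π ↭ range n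
φ-perm {π} π↭ = φ-fuel-perm (length π) π (≤-reflexive (sym (length-perm π↭))) π↭

last-skew-direct-one : ∀ X Y → last (X ⊖ (Y ⊕ [ 1 ])) ≡ just (suc (length Y))
last-skew-direct-one X Y =
  trans (cong last (sym (++-assoc (map (_+ length (Y ⊕ [ 1 ])) X) Y [ suc (length Y) ])))
        (last-∷ʳ (map (_+ length (Y ⊕ [ 1 ])) X ++ Y) (suc (length Y)))

-- If π ∈ S_n ends in a then φ(π) = φ(β) ⊖ (φ(α) ⊕ 1) ends in |α| + 1 = n - a + 1.
last-φ : ∀ {π n a} → π ↭ range n → last π ≡ just a → last (φ π) ≡ just (suc (n ∸ a))
last-φ {x ∷ xs} {n} {a} π↭ eq =
  trans (last-skew-direct-one (φ-fuel (length xs) (decβ (x ∷ xs))) φα) (cong (just ∘ suc) length-φα)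
  where
    φα = φ-fuel (length xs) (decα (x ∷ xs))
    fits = pieces-fit (proj₁ (last-range π↭ eq)) (proj₂ (last-range π↭ eq))
                      (≤-reflexive (sym (length-perm π↭)))
    length-φα : length φα ≡ n ∸ a
    length-φα = length-perm (φ-fuel-perm (length xs) (decα (x ∷ xs)) (proj₂ fits)
                                         (proj₂ (decomposition-perm π↭ eq)))

last-complement : ∀ {π n a} → π ↭ range n → last π ≡ just a →
  ∃[ b ] (last (φ π) ≡ just b × (a ∸ 1 ≡ n ∸ b) × (n ∸ a ≡ b ∸ 1))
last-complement {π} {n} {a} π↭ eq = suc (n ∸ a) , last-φ π↭ eq , complement , refl
  where
    complement : a ∸ 1 ≡ n ∸ suc (n ∸ a)
    complement = sym (begin
      n ∸ suc (n ∸ a)                        ≡⟨ cong (_∸ suc (n ∸ a)) (sym (split-at-letter 1≤a a≤n)) ⟩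
      a ∸ 1 + suc (n ∸ a) ∸ suc (n ∸ a)      ≡⟨ m+n∸n≡m (a ∸ 1) (suc (n ∸ a)) ⟩
      a ∸ 1                                  ∎)
      where
        1≤a = proj₁ (last-range π↭ eq)
        a≤n = proj₂ (last-range π↭ eq)

proposition1 : (n : ℕ) (π : List ℕ) → InS132 n π →
    (hook12 π ≡ hook21 (φ π)) × (hook21 π ≡ hook12 (φ π)) ×
    ((a : ℕ) → last π ≡ just a →
      ∃[ b ] (last (φ π) ≡ just b × (a ∸ 1 ≡ n ∸ b) × (n ∸ a ≡ b ∸ 1)))
proposition1 n [] _ = refl , refl , λ _ ()
proposition1 n π@(x ∷ xs) (π↭ , _) with last-∷ x xs
... | a , last-π with last-complement π↭ last-π
... | b , last-φπ , a∸1≡n∸b , n∸a≡b∸1 = hook12≡ , hook21≡ , λ _ → last-complement π↭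
  where
    hooks-π = hooks-of-perm π↭ last-π
    hooks-φπ = hooks-of-perm (φ-perm π↭) last-φπ
    hook12≡ : hook12 π ≡ hook21 (φ π)
    hook12≡ = begin
      hook12 π       ≡⟨ proj₁ hooks-π ⟩
      a ∸ 1          ≡⟨ a∸1≡n∸b ⟩
      n ∸ b          ≡⟨ sym (proj₂ hooks-φπ) ⟩
      hook21 (φ π)   ∎
    hook21≡ : hook21 π ≡ hook12 (φ π)
    hook21≡ = begin
      hook21 π       ≡⟨ proj₂ hooks-π ⟩
      n ∸ a          ≡⟨ n∸a≡b∸1 ⟩
      b ∸ 1          ≡⟨ sym (proj₁ hooks-φπ) ⟩
      hook12 (φ π)   ∎
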